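{- Let $l\in\mathbb{N}$, let $\mathcal{F}$ be a $ZFSP$-family and let $A\in\mathcal{F}$. Then for any $l$ sequences $\langle x_{n}^{(1)}\rangle_{n=1}^{\infty},\ldots,\langle x_{n}^{(l)}\rangle_{n=1}^{\infty}$ in $\mathbb{N}$ there exist, for each $i\in\{1,\ldots,l\}$, a sum subsystem $\langle y_{n}^{(i)}\rangle_{n=1}^{\infty}$ of $\langle x_{n}^{(i)}\rangle_{n=1}^{\infty}$ such that $$ZFS\left(\langle y_{n}^{(i)}\rangle_{i,n=1,1}^{l,\infty}\right)\cup ZFP\left(\langle y_{n}^{(i)}\rangle_{i,n=1,1}^{l,\infty}\right)\subseteq A.$$
   Context: An $IP^{\star}$-set in $(\mathbb{N},+)$ is a set meeting every set of the form $\{\sum_{t\in H}x_t:H\text{ nonempty finite}\subseteq\mathbb{N}\}$ with $\langle x_t\rangle$ a sequence in $\mathbb{N}$. For $A\subseteq\mathbb{N}$ and $n\in\mathbb{N}$: $-n+A=\{m:n+m\in A\}$ and $n^{ -1}A=\{m:nm\in A\}$. A family $\mathcal{F}$ of nonempty subsets of $\mathbb{N}$ is a $ZFSP$-family if: (a) every $A\in\mathcal{F}$ is an $IP^{\star}$-set in $(\mathbb{N},+)$; (b) for each $A\in\mathcal{F}$ there is $C\in\mathcal{F}$ with $C\subseteq A$ such that $-n+C\in\mathcal{F}$ for every $n\in C$; (c) $A,B\in\mathcal{F}$ implies $A\cap B\in\mathcal{F}$; (d) $n\in\mathbb{N}$, $A\in\mathcal{F}$ implies $n^{ -1}A\in\mathcal{F}$.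 A sum subsystem of $\langle x_n\rangle_{n=1}^\infty$ is a sequence $\langle y_n\rangle_{n=1}^\infty$ with $y_n=\sum_{t\in H_n}x_t$ for nonempty finite $H_n\subseteq\mathbb{N}$ satisfying $\max H_n<\min H_{n+1}$. For sequences $\langle y_n^{(i)}\rangle$, $i=1,\dots,l$: $ZFS$ is the set of all $\sum_{t\in H}z_t$ and $ZFP$ the set of all $\prod_{t\in H}z_t$, where $H$ ranges over nonempty finite subsets of $\mathbb{N}$ and, for each $t$, $z_t\in\{y_t^{(1)},\dots,y_t^{(l)}\}$ is arbitrary. -}

module Defs where

open import Data.Nat using (ℕ; zero; suc; _+_; _*_; _<_)
open import Data.Fin using (Fin)
open import Data.List using (List; []; map)
open import Data.Nat.ListAction using (sum; product)
open import Data.List.Membership.Propositional using (_∈_)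
open import Data.List.Relation.Unary.Linked using (Linked)
open import Data.Product using (Σ; ∃; _×_)
open import Data.Empty using (⊥)
open import Relation.Nullary using (¬_)
open import Relation.Binary.PropositionalEquality using (_≡_)

-- Convention: the paper's ℕ = {1,2,3,...}.  We use Agda's ℕ (which has 0)
-- and restrict everything to positive numbers explicitly.

SubSet : Set₁
SubSet = ℕ → Set

_⊆_ : SubSet → SubSet → Set
A ⊆ B = ∀ m → A m → B m

_∩_ : SubSet → SubSet → SubSet
(A ∩ B) m = A m × B m

Family : Set₂
Family = SubSet → Set₁

-- A nonempty finite subset of ℕ, represented as a nonempty strictly
-- increasing list of its elements.
record FinNE : Set where
  constructor finNE
  field
    elems    : List ℕ
    nonempty : ¬ (elems ≡ [])
    sorted   : Linked _<_ elems
open FinNE public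

ΣH : FinNE → (ℕ → ℕ) → ℕ
ΣH H x = sum (map x (elems H))

ΠH : FinNE → (ℕ → ℕ) → ℕ
ΠH H x = product (map x (elems H))

PosSeq : (ℕ → ℕ) → Set
PosSeq x = ∀ t → 0 < x t

IPStar : SubSet → Set
IPStar A = ∀ (x : ℕ → ℕ) → PosSeq x → Σ FinNE (λ H → A (ΣH H x))

shift : ℕ → SubSet → SubSet
shift n A m = (0 < m) × A (n + m)

divSet : ℕ → SubSet → SubSet
divSet n A m = (0 < m) × A (n * m)

PosSubSet : SubSet → Set
PosSubSet A = ∀ m → A m → 0 < m

Nonempty : SubSet → Set
Nonempty A = ∃ λ m → A m

record ZFSPFamily (𝓕 : Family) : Set₁ where
  field
    -- 𝓕 is a family of sets (membership invariant under equality of sets)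
    extensional : ∀ A B → A ⊆ B → B ⊆ A → 𝓕 A → 𝓕 B
    positive    : ∀ A → 𝓕 A → PosSubSet A
    nonempty    : ∀ A → 𝓕 A → Nonempty A
    ipStar      : ∀ A → 𝓕 A → IPStar A
    shiftClosed : ∀ A → 𝓕 A →
                  Σ SubSet (λ C → 𝓕 C × (C ⊆ A) × (∀ n → C n → 𝓕 (shift n C)))
    interClosed : ∀ A B → 𝓕 A → 𝓕 B → 𝓕 (A ∩ B)
    divClosed   : ∀ n → 0 < n → ∀ A → 𝓕 A → 𝓕 (divSet n A)

SumSubsystemVia : (ℕ → ℕ) → (ℕ → FinNE) → (ℕ → ℕ) → Set
SumSubsystemVia x H y =
  (∀ n → y n ≡ ΣH (H n) x) ×
  (∀ n a b → a ∈ elems (H n) → b ∈ elems (H (suc n)) → a < b)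

SumSubsystem : (ℕ → ℕ) → (ℕ → ℕ) → Set
SumSubsystem x y = Σ (ℕ → FinNE) (λ H → SumSubsystemVia x H y)

-- ZFS / ZFP of an l-tuple of sequences y : Fin l → ℕ → ℕ :
-- sums / products over H of z_t = y (c t) t with c an arbitrary choice.
InZFS : (l : ℕ) → (Fin l → ℕ → ℕ) → ℕ → Set
InZFS l y m = Σ FinNE (λ H → Σ (ℕ → Fin l) (λ c → m ≡ ΣH H (λ t → y (c t) t)))

InZFP : (l : ℕ) → (Fin l → ℕ → ℕ) → ℕ → Set
InZFP l y m = Σ FinNE (λ H → Σ (ℕ → Fin l) (λ c → m ≡ ΠH H (λ t → y (c t) t)))

-- Build a decreasing chain A = G₀ ⊇ G₁ ⊇ ⋯ in 𝓕.  At stage n, shrink Gₙ to a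
-- shift-closed C ∈ 𝓕 and, C being IP*, pick for each i a block sum yₙ⁽ⁱ⁾ ∈ C
-- of x⁽ⁱ⁾ beyond all earlier blocks; then let G_{n+1} be C intersected with
-- every -yₙ⁽ⁱ⁾ + C and (yₙ⁽ⁱ⁾)⁻¹C.  Any sum or product of chosen terms over
-- t₀ < t₁ < ⋯ then lies in G_{t₀} ⊆ A, by induction from the last index.
module Submission where

open import Defs
open import Data.Nat using (ℕ; zero; suc; _+_; _*_; _<_; _≤_; _≤′_; ≤′-refl; ≤′-step; z≤n; s≤s)
open import Data.Nat.ListAction using (sum)
open import Data.Nat.Properties
  using (+-identityʳ; *-identityʳ; +-monoʳ-<; m≤m+n; <-≤-trans; ≤⇒≤′)
open import Data.Fin using (Fin)
import Data.Fin as Fin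
open import Data.List using (List; []; _∷_; map; foldr)
open import Data.List.Properties using (map-∘)
open import Data.List.Extrema.Nat using (max; xs≤max)
import Data.List.Relation.Unary.All as All
open import Data.List.Membership.Propositional using (_∈_)
open import Data.List.Membership.Propositional.Properties using (∈-map⁻)
open import Data.List.Relation.Unary.Linked using (Linked; _∷_)
import Data.List.Relation.Unary.Linked as Linked
import Data.List.Relation.Unary.Linked.Properties as Linked
open import Data.Product using (Σ; _×_; _,_; proj₁; proj₂)
open import Data.Empty using (⊥-elim)
open import Function using (_∘_)
open import Relation.Binary.PropositionalEquality using (_≡_; refl; sym; cong; subst)

map≡[]⇒≡[] : {f : ℕ → ℕ} (xs : List ℕ) → map f xs ≡ [] → xs ≡ []
map≡[]⇒≡[] [] _ = refl

translate : ℕ → FinNE → FinNE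
translate N H = finNE (map (N +_) (elems H))
                      (nonempty H ∘ map≡[]⇒≡[] (elems H))
                      (Linked.map⁺ (Linked.map (+-monoʳ-< N) (sorted H)))

ΣH-translate : ∀ N H (x : ℕ → ℕ) → ΣH H (λ t → x (N + t)) ≡ ΣH (translate N H) x
ΣH-translate N H x = cong sum (map-∘ (elems H))

translateEnd : ℕ → FinNE → ℕ
translateEnd N H = N + suc (max 0 (elems H))

∈-translate⇒bounded : ∀ N H {a} → a ∈ elems (translate N H) → N ≤ a × a < translateEnd N H
∈-translate⇒bounded N H a∈ with ∈-map⁻ (N +_) a∈
... | h , h∈H , refl = m≤m+n N h , +-monoʳ-< N (s≤s (All.lookup (xs≤max 0 (elems H)) h∈H))

meet : ∀ {k} → SubSet → (Fin k → SubSet) → SubSet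
meet {zero}  D f = D
meet {suc k} D f = f Fin.zero ∩ meet D (f ∘ Fin.suc)

meet-⊆ˡ : ∀ {k} D (f : Fin k → SubSet) → meet D f ⊆ D
meet-⊆ˡ {zero}  D f m p       = p
meet-⊆ˡ {suc k} D f m (_ , p) = meet-⊆ˡ D (f ∘ Fin.suc) m p

meet-⊆ : ∀ {k} D (f : Fin k → SubSet) i → meet D f ⊆ f i
meet-⊆ D f Fin.zero    m (p , _) = p
meet-⊆ D f (Fin.suc i) m (_ , p) = meet-⊆ D (f ∘ Fin.suc) i m p

Antitone : (ℕ → SubSet) → Set
Antitone G = ∀ n → G (suc n) ⊆ G n

antitone-⊆ : ∀ {G} → Antitone G → ∀ {m n} → m ≤ n → G n ⊆ G m
antitone-⊆ {G} G↓ = go ∘ ≤⇒≤′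
  where
  go : ∀ {m n} → m ≤′ n → G n ⊆ G m
  go ≤′-refl          = λ _ p → p
  go (≤′-step m≤′n) = λ k p → go m≤′n k (G↓ _ k p)

module _ (_∙_ : ℕ → ℕ → ℕ) (ε : ℕ) (∙-identityʳ : ∀ a → a ∙ ε ≡ a)
         {G : ℕ → SubSet} (G↓ : Antitone G) (z : ℕ → ℕ)
         (z∈G : ∀ t → G t (z t)) (z∙-closed : ∀ t w → G (suc t) w → G t (z t ∙ w)) where

  foldr-∈-head : ∀ t L → Linked _<_ (t ∷ L) → G t (foldr _∙_ ε (map z (t ∷ L)))
  foldr-∈-head t []      _            = subst (G t) (sym (∙-identityʳ (z t))) (z∈G t)
  foldr-∈-head t (u ∷ L) (t<u ∷ t∷L↑) =
    z∙-closed t _ (antitone-⊆ G↓ t<u _ (foldr-∈-head u L t∷L↑))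

  foldr-∈-G₀ : ∀ H → G 0 (foldr _∙_ ε (map z (elems H)))
  foldr-∈-G₀ (finNE []      ≢[] _)  = ⊥-elim (≢[] refl)
  foldr-∈-G₀ (finNE (t ∷ L) _   L↑) = antitone-⊆ G↓ z≤n _ (foldr-∈-head t L L↑)

module Construction {𝓕 : Family} (𝓕-ZFSP : ZFSPFamily 𝓕) (A : SubSet) (A∈𝓕 : 𝓕 A)
                    {l : ℕ} (x : Fin l → ℕ → ℕ) (x-pos : ∀ i → PosSeq (x i)) where
  open ZFSPFamily 𝓕-ZFSP

  𝓕-meet : ∀ {k D} {f : Fin k → SubSet} → 𝓕 D → (∀ i → 𝓕 (f i)) → 𝓕 (meet D f)
  𝓕-meet {zero}  D∈𝓕 f∈𝓕 = D∈𝓕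
  𝓕-meet {suc k} D∈𝓕 f∈𝓕 = interClosed _ _ (f∈𝓕 Fin.zero) (𝓕-meet D∈𝓕 (f∈𝓕 ∘ Fin.suc))

  record Stage : Set₁ where
    constructor stage
    field
      set    : SubSet
      set∈𝓕  : 𝓕 set
      offset : Fin l → ℕ

  module _ (s : Stage) where
    open Stage s

    core : SubSet
    core = proj₁ (shiftClosed set set∈𝓕)

    core∈𝓕 : 𝓕 core
    core∈𝓕 = proj₁ (proj₂ (shiftClosed set set∈𝓕))

    core⊆set : core ⊆ set
    core⊆set = proj₁ (proj₂ (proj₂ (shiftClosed set set∈𝓕)))

    core-shift∈𝓕 : ∀ n → core n → 𝓕 (shift n core)
    core-shift∈𝓕 = proj₂ (proj₂ (proj₂ (shiftClosed set set∈𝓕)))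

    tail : Fin l → ℕ → ℕ
    tail i t = x i (offset i + t)

    private
      termInCore : ∀ i → Σ FinNE (λ H → core (ΣH H (tail i)))
      termInCore i = ipStar core core∈𝓕 (tail i) (λ t → x-pos i (offset i + t))

    block : Fin l → FinNE
    block i = proj₁ (termInCore i)

    term : Fin l → ℕ
    term i = ΣH (block i) (tail i)

    term∈core : ∀ i → core (term i)
    term∈core i = proj₂ (termInCore i)

    term∈set : ∀ i → set (term i)
    term∈set i = core⊆set _ (term∈core i)

    absorber : Fin l → SubSet
    absorber i = shift (term i) core ∩ divSet (term i) core

    absorber∈𝓕 : ∀ i → 𝓕 (absorber i)
    absorber∈𝓕 i = interClosed _ _
      (core-shift∈𝓕 _ (term∈core i))
      (divClosed _ (positive _ core∈𝓕 _ (term∈core i)) _ core∈𝓕)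

    next : Stage
    next = stage (meet core absorber) (𝓕-meet core∈𝓕 absorber∈𝓕)
                 (λ i → translateEnd (offset i) (block i))

    next⊆set : Stage.set next ⊆ set
    next⊆set m p = core⊆set m (meet-⊆ˡ core absorber m p)

    +term-closed : ∀ i w → Stage.set next w → set (term i + w)
    +term-closed i w p = core⊆set _ (proj₂ (proj₁ (meet-⊆ core absorber i w p)))

    *term-closed : ∀ i w → Stage.set next w → set (term i * w)
    *term-closed i w p = core⊆set _ (proj₂ (proj₂ (meet-⊆ core absorber i w p)))

  stages : ℕ → Stage
  stages zero    = stage A A∈𝓕 (λ _ → 0)
  stages (suc n) = next (stages n)

  G : ℕ → SubSet
  G n = Stage.set (stages n)

  G↓ : Antitone G
  G↓ n = next⊆set (stages n)

  y : Fin l → ℕ → ℕ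
  y i n = term (stages n) i

  y-sumSubsystem : ∀ i → SumSubsystem (x i) (y i)
  y-sumSubsystem i = blocks , (λ n → ΣH-translate (offset n) (block (stages n) i) (x i)) , blocks↑
    where
    offset : ℕ → ℕ
    offset n = Stage.offset (stages n) i

    blocks : ℕ → FinNE
    blocks n = translate (offset n) (block (stages n) i)

    blocks↑ : ∀ n a b → a ∈ elems (blocks n) → b ∈ elems (blocks (suc n)) → a < b
    blocks↑ n a b a∈ b∈ =
      <-≤-trans (proj₂ (∈-translate⇒bounded (offset n) (block (stages n) i) a∈))
                (proj₁ (∈-translate⇒bounded (offset (suc n)) (block (stages (suc n)) i) b∈))

  -- ΣH and ΠH unfold to foldr _+_ 0 and foldr _*_ 1, and G 0 reduces to A.
  ZFS⊆A : ∀ m → InZFS l y m → A m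
  ZFS⊆A _ (H , c , refl) =
    foldr-∈-G₀ _+_ 0 +-identityʳ G↓ (λ t → y (c t) t)
      (λ t → term∈set (stages t) (c t)) (λ t → +term-closed (stages t) (c t)) H

  ZFP⊆A : ∀ m → InZFP l y m → A m
  ZFP⊆A _ (H , c , refl) =
    foldr-∈-G₀ _*_ 1 *-identityʳ G↓ (λ t → y (c t) t)
      (λ t → term∈set (stages t) (c t)) (λ t → *term-closed (stages t) (c t)) H

mainTheorem5 : (l : ℕ) (𝓕 : Family) → ZFSPFamily 𝓕 → (A : SubSet) → 𝓕 A →
               (x : Fin l → ℕ → ℕ) → (∀ i → PosSeq (x i)) →
               Σ (Fin l → ℕ → ℕ) (λ y →
                 (∀ i → SumSubsystem (x i) (y i)) ×
                 (∀ m → InZFS l y m → A m) ×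
                 (∀ m → InZFP l y m → A m))
mainTheorem5 l 𝓕 𝓕-ZFSP A A∈𝓕 x x-pos = y , y-sumSubsystem , ZFS⊆A , ZFP⊆A
  where open Construction 𝓕-ZFSP A A∈𝓕 x x-pos
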